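{- Let $n \geq 2$ be an integer and $S \subseteq \{1, \dots, \lfloor n/2 \rfloor\}$. For every vertex $v$ of $\mathsf{Circ}(n,S)$: if $n \equiv 0 \pmod 3$ and $\frac{n}{3} \in S$, then $e(v) \equiv 1 \pmod 3$; otherwise $e(v) \equiv 0 \pmod 3$.
   Context: For an integer $n \geq 2$ and $S \subseteq \{1, \dots, \lfloor n/2 \rfloor\}$, the circulant $\mathsf{Circ}(n,S)$ is the Cayley graph of $\mathbb{Z}_n$ with connection set $S \cup -S$: vertex set $\mathbb{Z}_n$, with $u$ and $w$ adjacent iff $w - u \in S \cup -S$. For a vertex $v$, $e(v)$ denotes the number of edges of the subgraph induced by the open neighbourhood of $v$. -}

module Defs where

open import Data.Nat using (ℕ; zero; suc; _+_; _∸_; _≤_; _<_; NonZero)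
open import Data.Nat.DivMod using (_%_; _/_)
open import Data.Bool using (Bool; true; false; _∨_; _∧_; if_then_else_)
open import Data.Fin using (Fin; toℕ)
open import Data.List using (List; length; filter; allFin; concatMap; map)
open import Data.Product using (_×_; _,_; proj₁; proj₂)
open import Data.Nat using (_<ᵇ_)
open import Relation.Binary.PropositionalEquality using (_≡_)
open import Relation.Nullary.Decidable using (Dec; yes; no)

ValidConn : (n : ℕ) → {{NonZero n}} → (ℕ → Bool) → Set
ValidConn n S = ∀ k → S k ≡ true → (1 ≤ k) × (k ≤ n / 2)

diff : (n : ℕ) → {{NonZero n}} → Fin n → Fin n → ℕ
diff n u w = (toℕ w + (n ∸ toℕ u)) % n

-- adjacency in Circ(n,S): w - u ∈ S ∪ -S  (i.e. w-u ∈ S or u-w ∈ S)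
adj : (n : ℕ) → {{NonZero n}} → (ℕ → Bool) → Fin n → Fin n → Bool
adj n S u w = S (diff n u w) ∨ S (diff n w u)

-- all pairs (a , b) of vertices with toℕ a < toℕ b (unordered pairs)
pairs : (n : ℕ) → List (Fin n × Fin n)
pairs n = concatMap (λ a → map (a ,_) (filter (λ b → decB (toℕ a <ᵇ toℕ b)) (allFin n))) (allFin n)
  where
  decB : (x : Bool) → Dec (x ≡ true)
  decB true = yes Relation.Binary.PropositionalEquality.refl
  decB false = no (λ ())

-- e(v): number of edges of the subgraph induced by the open neighbourhood N(v)
e : (n : ℕ) → {{NonZero n}} → (ℕ → Bool) → Fin n → ℕ
e n S v = length (filter (λ p → decB (adj n S v (proj₁ p) ∧ adj n S v (proj₂ p) ∧ adj n S (proj₁ p) (proj₂ p))) (pairs n))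
  where
  decB : (x : Bool) → Dec (x ≡ true)
  decB true = yes Relation.Binary.PropositionalEquality.refl
  decB false = no (λ ())

{-# OPTIONS --safe #-}
-- Counting pairs a < b with {v, a, b} a triangle, the symmetry of the triangle predicate and the
-- absence of loops (0 ∉ S) give 2·e(v) = #{(a , b) : {v, a, b} is a triangle}, and translating by
-- −v turns this into the same count for v = 0. The map ρ (a , b) = (b − a , −a) has order 3 and
-- maps triangles through 0 to triangles through 0, so the triangles it moves come in orbits of
-- size 3. Its fixed points satisfy b ≡ 2a and 3a ≡ 0 (mod n): apart from (0 , 0), which is no
-- triangle, they exist only when n = 3m, namely (m , 2m) and (2m , m), and these are triangles
-- exactly when m ∈ S, since 2m > ⌊n/2⌋ is never in S. Hence 2·e(v) ≡ 2 or 0 (mod 3) according as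
-- n/3 ∈ S or not, that is, e(v) ≡ 1 or 0.
module Submission where

open import Defs
open import Data.Bool using (Bool; true; false; not; _∧_; _∨_)
open import Data.Bool.Properties using (∧-comm; ∧-assoc; ∧-idem; ∧-zeroʳ; ∧-identityʳ; ∨-comm; ∨-identityʳ)
open import Data.Fin as Fin using (Fin; toℕ)
open import Data.Fin.Properties using (toℕ<n)
open import Data.List using (List; []; _∷_; length; filter; allFin; concatMap; map; tabulate)
open import Data.List.Properties using (map-∘; map-tabulate; map-concatMap)
open import Data.Nat
open import Data.Nat.DivMod
open import Data.Nat.Divisibility using (_∣_; divides)
open import Data.Nat.ListAction using (sum)
open import Data.Nat.ListAction.Properties using (sum-++)
open import Data.Nat.Properties
open import Algebra.Properties.CommutativeSemigroup +-commutativeSemigroup using (interchange)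
open import Data.Nat.Solver using (module +-*-Solver)
open import Data.Product using (_×_; _,_; proj₁; proj₂; ∃-syntax)
open import Data.Product.Properties using (≡-dec)
open import Data.Sum using (_⊎_; inj₁; inj₂)
open import Function using (_∘_; id)
open import Relation.Binary.Definitions using (tri<; tri≈; tri>)
open import Relation.Binary.PropositionalEquality
open import Relation.Nullary using (¬_; Dec; does; yes; no; contradiction)
open import Relation.Nullary.Decidable using (dec-true; dec-false)
open import Relation.Nullary.Reflects using (ofʸ; ofⁿ)
open +-*-Solver using (solve; _:+_; _:*_; _:=_; con)
open ≡-Reasoning

⟦_⟧ : Bool → ℕ
⟦ true ⟧  = 1
⟦ false ⟧ = 0

⟦⟧-split : ∀ p q → ⟦ p ⟧ ≡ ⟦ p ∧ q ⟧ + ⟦ p ∧ not q ⟧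
⟦⟧-split false q     = refl
⟦⟧-split true  true  = refl
⟦⟧-split true  false = refl

[m%n+k]%n≡[m+k]%n : ∀ m k n .{{_ : NonZero n}} → (m % n + k) % n ≡ (m + k) % n
[m%n+k]%n≡[m+k]%n m k n = begin
  (m % n + k) % n          ≡⟨ %-distribˡ-+ (m % n) k n ⟩
  (m % n % n + k % n) % n  ≡⟨ cong (λ r → (r + k % n) % n) (m%n%n≡m%n m n) ⟩
  (m % n + k % n) % n      ≡⟨ %-distribˡ-+ m k n ⟨
  (m + k) % n              ∎

double : ∀ m → m + m ≡ 2 * m
double = solve 1 (λ m → m :+ m := con 2 :* m) refl

triple : ∀ m → m + m + m ≡ 3 * m
triple = solve 1 (λ m → m :+ m :+ m := con 3 :* m) refl

n≡3m⇒n%3≡0 : ∀ {n m} → n ≡ 3 * m → n % 3 ≡ 0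
n≡3m⇒n%3≡0 {m = m} refl = trans (cong (_% 3) (*-comm 3 m)) (m*n%n≡0 m 3)

n≡3m⇒n/3≡m : ∀ {n m} → n ≡ 3 * m → n / 3 ≡ m
n≡3m⇒n/3≡m {m = m} refl = trans (cong (_/ 3) (*-comm 3 m)) (m*n/n≡m m 3)

n%3≡0⇒n≡3[n/3] : ∀ {n} → n % 3 ≡ 0 → n ≡ 3 * (n / 3)
n%3≡0⇒n≡3[n/3] {n} n%3≡0 = begin
  n                  ≡⟨ m≡m%n+[m/n]*n n 3 ⟩
  n % 3 + n / 3 * 3  ≡⟨ cong (_+ n / 3 * 3) n%3≡0 ⟩
  n / 3 * 3          ≡⟨ *-comm (n / 3) 3 ⟩
  3 * (n / 3)        ∎

half-mod-3 : ∀ e c t → 3 ∣ t → e + e ≡ c + c + t → e % 3 ≡ c % 3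
half-mod-3 e c t (divides k refl) e+e≡ = begin
  e % 3                              ≡⟨ [m+kn]%n≡m%n e e 3 ⟨
  (e + e * 3) % 3                    ≡⟨ cong (_% 3) (quadruple e) ⟩
  ((e + e) + (e + e)) % 3            ≡⟨ cong (λ s → (s + s) % 3) e+e≡ ⟩
  ((c + c + k * 3) + (c + c + k * 3)) % 3 ≡⟨ cong (_% 3) (regroup c k) ⟩
  (c + (c + k + k) * 3) % 3          ≡⟨ [m+kn]%n≡m%n c (c + k + k) 3 ⟩
  c % 3                              ∎
  where
  quadruple : ∀ e → e + e * 3 ≡ (e + e) + (e + e)
  quadruple = solve 1 (λ e → e :+ e :* con 3 := (e :+ e) :+ (e :+ e)) refl
  regroup : ∀ c k → (c + c + k * 3) + (c + c + k * 3) ≡ c + (c + k + k) * 3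
  regroup = solve 2 (λ c k → (c :+ c :+ k :* con 3) :+ (c :+ c :+ k :* con 3) := c :+ (c :+ k :+ k) :* con 3) refl

<⇒<ᵇ≡true : ∀ {m n} → m < n → (m <ᵇ n) ≡ true
<⇒<ᵇ≡true {m} {n} m<n with m <ᵇ n | <ᵇ-reflects-< m n
... | true  | _        = refl
... | false | ofⁿ m≮n = contradiction m<n m≮n

>⇒<ᵇ≡false : ∀ {m n} → n < m → (m <ᵇ n) ≡ false
>⇒<ᵇ≡false {m} {n} n<m with m <ᵇ n | <ᵇ-reflects-< m n
... | true  | ofʸ m<n = contradiction m<n (<-asym n<m)
... | false | _       = refl

isLeast : ℕ → ℕ → ℕ → Bool
isLeast p q r = (p <ᵇ q) ∧ (p <ᵇ r)

leastCount : ℕ → ℕ → ℕ → ℕ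
leastCount p q r = ⟦ isLeast p q r ⟧ + ⟦ isLeast q r p ⟧ + ⟦ isLeast r p q ⟧

leastCount-rotate : ∀ p q r → leastCount p q r ≡ leastCount q r p
leastCount-rotate p q r = begin
  ⟦ isLeast p q r ⟧ + ⟦ isLeast q r p ⟧ + ⟦ isLeast r p q ⟧    ≡⟨ +-assoc ⟦ isLeast p q r ⟧ _ _ ⟩
  ⟦ isLeast p q r ⟧ + (⟦ isLeast q r p ⟧ + ⟦ isLeast r p q ⟧)  ≡⟨ +-comm ⟦ isLeast p q r ⟧ _ ⟩
  ⟦ isLeast q r p ⟧ + ⟦ isLeast r p q ⟧ + ⟦ isLeast p q r ⟧    ∎

leastCount-of-least : ∀ {p q r} → p < q → p < r → leastCount p q r ≡ 1
leastCount-of-least {p} {q} {r} p<q p<r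
  rewrite <⇒<ᵇ≡true p<q | <⇒<ᵇ≡true p<r | >⇒<ᵇ≡false p<q | >⇒<ᵇ≡false p<r | ∧-zeroʳ (q <ᵇ r) = refl

leastCount-distinct : ∀ {p q r} → p ≢ q → q ≢ r → r ≢ p → leastCount p q r ≡ 1
leastCount-distinct {p} {q} {r} p≢q q≢r r≢p with <-cmp p q | <-cmp q r | <-cmp r p
... | tri< p<q _ _ | _             | tri> _ _ p<r = leastCount-of-least p<q p<r
... | tri> _ _ q<p | tri< q<r _ _  | _            =
  trans (leastCount-rotate p q r) (leastCount-of-least q<r q<p)
... | _            | tri> _ _ r<q  | tri< r<p _ _ =
  trans (leastCount-rotate p q r) (trans (leastCount-rotate q r p) (leastCount-of-least r<p r<q))
... | tri< p<q _ _ | tri< q<r _ _  | tri< r<p _ _ = contradiction (<-trans p<q q<r) (<-asym r<p)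
... | tri> _ _ q<p | tri> _ _ r<q  | tri> _ _ p<r = contradiction (<-trans r<q q<p) (<-asym p<r)
... | tri≈ _ p≡q _ | _             | _            = contradiction p≡q p≢q
... | _            | tri≈ _ q≡r _  | _            = contradiction q≡r q≢r
... | _            | _             | tri≈ _ r≡p _ = contradiction r≡p r≢p

∑ : ℕ → (ℕ → ℕ) → ℕ
∑ zero    f = 0
∑ (suc n) f = f 0 + ∑ n (f ∘ suc)

∑-cong : ∀ n {f g : ℕ → ℕ} → (∀ i → i < n → f i ≡ g i) → ∑ n f ≡ ∑ n g
∑-cong zero    f≡g = refl
∑-cong (suc n) f≡g = cong₂ _+_ (f≡g 0 z<s) (∑-cong n (λ i i<n → f≡g (suc i) (s<s i<n)))

∑-zero : ∀ n {f : ℕ → ℕ} → (∀ i → i < n → f i ≡ 0) → ∑ n f ≡ 0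
∑-zero zero    f≡0 = refl
∑-zero (suc n) f≡0 = cong₂ _+_ (f≡0 0 z<s) (∑-zero n (λ i i<n → f≡0 (suc i) (s<s i<n)))

∑-last : ∀ n f → ∑ (suc n) f ≡ ∑ n f + f n
∑-last zero    f = +-comm (f 0) 0
∑-last (suc n) f = begin
  f 0 + ∑ (suc n) (f ∘ suc)          ≡⟨ cong (f 0 +_) (∑-last n (f ∘ suc)) ⟩
  f 0 + (∑ n (f ∘ suc) + f (suc n))  ≡⟨ +-assoc (f 0) _ _ ⟨
  ∑ (suc n) f + f (suc n)            ∎

∑-distrib-+ : ∀ n f g → ∑ n (λ i → f i + g i) ≡ ∑ n f + ∑ n g
∑-distrib-+ zero    f g = refl
∑-distrib-+ (suc n) f g = begin
  f 0 + g 0 + ∑ n (λ i → f (suc i) + g (suc i))  ≡⟨ cong (f 0 + g 0 +_) (∑-distrib-+ n (f ∘ suc) (g ∘ suc)) ⟩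
  f 0 + g 0 + (∑ n (f ∘ suc) + ∑ n (g ∘ suc))    ≡⟨ interchange (f 0) (g 0) _ _ ⟩
  ∑ (suc n) f + ∑ (suc n) g                      ∎

∑-comm : ∀ m n (f : ℕ → ℕ → ℕ) → ∑ m (λ i → ∑ n (f i)) ≡ ∑ n (λ j → ∑ m (λ i → f i j))
∑-comm zero    n f = sym (∑-zero n (λ _ _ → refl))
∑-comm (suc m) n f = begin
  ∑ n (f 0) + ∑ m (λ i → ∑ n (f (suc i)))           ≡⟨ cong (∑ n (f 0) +_) (∑-comm m n (f ∘ suc)) ⟩
  ∑ n (f 0) + ∑ n (λ j → ∑ m (λ i → f (suc i) j))   ≡⟨ ∑-distrib-+ n (f 0) _ ⟨
  ∑ n (λ j → ∑ (suc m) (λ i → f i j))               ∎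

∑-rotate : ∀ n .{{_ : NonZero n}} f → ∑ n (λ i → f (suc i % n)) ≡ ∑ n f
∑-rotate (suc m) f = begin
  ∑ (suc m) (f ∘ next)         ≡⟨ ∑-last m (f ∘ next) ⟩
  ∑ m (f ∘ next) + f (next m)  ≡⟨ cong₂ _+_ (∑-cong m (λ i i<m → cong f (m<n⇒m%n≡m (s<s i<m)))) (cong f (n%n≡0 (suc m))) ⟩
  ∑ m (f ∘ suc) + f 0          ≡⟨ +-comm _ (f 0) ⟩
  ∑ (suc m) f                  ∎
  where
  next : ℕ → ℕ
  next i = suc i % suc m

∑-translate : ∀ n .{{_ : NonZero n}} c f → ∑ n (λ i → f ((i + c) % n)) ≡ ∑ n f
∑-translate n zero    f = ∑-cong n (λ i i<n → cong f (trans (cong (_% n) (+-identityʳ i)) (m<n⇒m%n≡m i<n)))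
∑-translate n (suc c) f = begin
  ∑ n (λ i → f ((i + suc c) % n))          ≡⟨ ∑-cong n (λ i _ → cong f (shift i)) ⟩
  ∑ n (λ i → f ((suc i % n + c) % n))      ≡⟨ ∑-rotate n (λ j → f ((j + c) % n)) ⟩
  ∑ n (λ j → f ((j + c) % n))              ≡⟨ ∑-translate n c f ⟩
  ∑ n f                                    ∎
  where
  shift : ∀ i → (i + suc c) % n ≡ (suc i % n + c) % n
  shift i = trans (cong (_% n) (+-suc i c)) (sym ([m%n+k]%n≡[m+k]%n (suc i) c n))

∑-reverse : ∀ n f → ∑ n f ≡ ∑ n (λ i → f (n ∸ suc i))
∑-reverse zero    f = refl
∑-reverse (suc n) f = begin
  ∑ (suc n) f                          ≡⟨ ∑-last n f ⟩
  ∑ n f + f n                          ≡⟨ cong (_+ f n) (∑-reverse n f) ⟩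
  ∑ n (λ i → f (n ∸ suc i)) + f n      ≡⟨ +-comm _ (f n) ⟩
  ∑ (suc n) (λ i → f (suc n ∸ suc i))  ∎

∑-negate : ∀ n .{{_ : NonZero n}} f → ∑ n (λ i → f ((n ∸ i) % n)) ≡ ∑ n f
∑-negate n f = begin
  ∑ n (λ i → f ((n ∸ i) % n))                ≡⟨ ∑-reverse n _ ⟩
  ∑ n (λ i → f ((n ∸ (n ∸ suc i)) % n))      ≡⟨ ∑-cong n (λ i i<n → cong (λ k → f (k % n)) (m∸[m∸n]≡n i<n)) ⟩
  ∑ n (λ i → f (suc i % n))                  ≡⟨ ∑-rotate n f ⟩
  ∑ n f                                      ∎

∑-single : ∀ n {c} f → c < n → (∀ i → i < n → i ≢ c → f i ≡ 0) → ∑ n f ≡ f c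
∑-single (suc n) {c} f c<1+n f≡0 with c ≟ n
... | yes refl = begin
  ∑ (suc n) f   ≡⟨ ∑-last n f ⟩
  ∑ n f + f n   ≡⟨ cong (_+ f n) (∑-zero n (λ i i<n → f≡0 i (m<n⇒m<1+n i<n) (<⇒≢ i<n))) ⟩
  f n           ∎
... | no c≢n = begin
  ∑ (suc n) f   ≡⟨ ∑-last n f ⟩
  ∑ n f + f n   ≡⟨ cong₂ _+_ (∑-single n f c<n (λ i i<n → f≡0 i (m<n⇒m<1+n i<n))) (f≡0 n ≤-refl (c≢n ∘ sym)) ⟩
  f c + 0       ≡⟨ +-identityʳ (f c) ⟩
  f c           ∎
  where
  c<n : c < n
  c<n = ≤∧≢⇒< (s≤s⁻¹ c<1+n) c≢n

∑-pair : ∀ n {c c′} f → c < c′ → c′ < n → (∀ i → i < n → i ≢ c → i ≢ c′ → f i ≡ 0) → ∑ n f ≡ f c + f c′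
∑-pair (suc n) {c} {c′} f c<c′ c′<1+n f≡0 with c′ ≟ n
... | yes refl = begin
  ∑ (suc n) f   ≡⟨ ∑-last n f ⟩
  ∑ n f + f n   ≡⟨ cong (_+ f n) (∑-single n f c<c′ (λ i i<n i≢c → f≡0 i (m<n⇒m<1+n i<n) i≢c (<⇒≢ i<n))) ⟩
  f c + f n     ∎
... | no c′≢n = begin
  ∑ (suc n) f   ≡⟨ ∑-last n f ⟩
  ∑ n f + f n   ≡⟨ cong₂ _+_ (∑-pair n f c<c′ c′<n (λ i i<n → f≡0 i (m<n⇒m<1+n i<n))) (f≡0 n ≤-refl (c≢n ∘ sym) (c′≢n ∘ sym)) ⟩
  f c + f c′ + 0  ≡⟨ +-identityʳ _ ⟩
  f c + f c′      ∎
  where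
  c′<n : c′ < n
  c′<n = ≤∧≢⇒< (s≤s⁻¹ c′<1+n) c′≢n
  c≢n : c ≢ n
  c≢n = <⇒≢ (<-trans c<c′ c′<n)

does-≡ : ∀ {b} (b? : Dec (b ≡ true)) → does b? ≡ b
does-≡ {true}  b? = dec-true b? refl
does-≡ {false} b? = dec-false b? (λ ())

module _ {A : Set} (q : A → Bool) (q? : ∀ x → Dec (q x ≡ true)) where

  length-filter≡sum : ∀ xs → length (filter q? xs) ≡ sum (map (⟦_⟧ ∘ q) xs)
  length-filter≡sum []       = refl
  length-filter≡sum (x ∷ xs) with does (q? x) | does-≡ (q? x)
  ... | true  | q≡ rewrite sym q≡ = cong suc (length-filter≡sum xs)
  ... | false | q≡ rewrite sym q≡ = length-filter≡sum xs

  sum-map-filter : ∀ (h : A → Bool) xs → sum (map (⟦_⟧ ∘ h) (filter q? xs)) ≡ sum (map (λ x → ⟦ q x ∧ h x ⟧) xs)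
  sum-map-filter h []       = refl
  sum-map-filter h (x ∷ xs) with does (q? x) | does-≡ (q? x)
  ... | true  | q≡ rewrite sym q≡ = cong (⟦ h x ⟧ +_) (sum-map-filter h xs)
  ... | false | q≡ rewrite sym q≡ = sum-map-filter h xs

sum-concatMap : ∀ {A : Set} (f : A → List ℕ) xs → sum (concatMap f xs) ≡ sum (map (sum ∘ f) xs)
sum-concatMap f []       = refl
sum-concatMap f (x ∷ xs) = trans (sum-++ (f x) (concatMap f xs)) (cong (sum (f x) +_) (sum-concatMap f xs))

sum-tabulate : ∀ n {f : Fin n → ℕ} (h : ℕ → ℕ) → (∀ i → f i ≡ h (toℕ i)) → sum (tabulate f) ≡ ∑ n h
sum-tabulate zero    h f≡h = refl
sum-tabulate (suc n) h f≡h = cong₂ _+_ (f≡h Fin.zero) (sum-tabulate n (h ∘ suc) (f≡h ∘ Fin.suc))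

length-filter-pairs : ∀ n (R Q : ℕ → ℕ → Bool)
  (r? : ∀ (a b : Fin n) → Dec (R (toℕ a) (toℕ b) ≡ true))
  (q? : ∀ (p : Fin n × Fin n) → Dec (Q (toℕ (proj₁ p)) (toℕ (proj₂ p)) ≡ true)) →
  length (filter q? (concatMap (λ a → map (a ,_) (filter (r? a) (allFin n))) (allFin n)))
    ≡ ∑ n (λ a → ∑ n (λ b → ⟦ R a b ∧ Q a b ⟧))
length-filter-pairs n R Q r? q? = begin
  length (filter q? (concatMap row (allFin n)))       ≡⟨ length-filter≡sum q q? (concatMap row (allFin n)) ⟩
  sum (map (⟦_⟧ ∘ q) (concatMap row (allFin n)))      ≡⟨ cong sum (map-concatMap (⟦_⟧ ∘ q) row (allFin n)) ⟩
  sum (concatMap (map (⟦_⟧ ∘ q) ∘ row) (allFin n))    ≡⟨ sum-concatMap (map (⟦_⟧ ∘ q) ∘ row) (allFin n) ⟩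
  sum (map (sum ∘ map (⟦_⟧ ∘ q) ∘ row) (allFin n))    ≡⟨ cong sum (map-tabulate id (sum ∘ map (⟦_⟧ ∘ q) ∘ row)) ⟩
  sum (tabulate (sum ∘ map (⟦_⟧ ∘ q) ∘ row))          ≡⟨ sum-tabulate n _ row-sum ⟩
  ∑ n (λ a → ∑ n (λ b → ⟦ R a b ∧ Q a b ⟧))            ∎
  where
  q : Fin n × Fin n → Bool
  q (a , b) = Q (toℕ a) (toℕ b)
  row : Fin n → List (Fin n × Fin n)
  row a = map (a ,_) (filter (r? a) (allFin n))
  row-sum : ∀ a → sum (map (⟦_⟧ ∘ q) (row a)) ≡ ∑ n (λ b → ⟦ R (toℕ a) b ∧ Q (toℕ a) b ⟧)
  row-sum a = begin
    sum (map (⟦_⟧ ∘ q) (row a))                                        ≡⟨ cong sum (map-∘ (filter (r? a) (allFin n))) ⟨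
    sum (map (⟦_⟧ ∘ q ∘ (a ,_)) (filter (r? a) (allFin n)))            ≡⟨ sum-map-filter _ (r? a) (q ∘ (a ,_)) (allFin n) ⟩
    sum (map (λ b → ⟦ R (toℕ a) (toℕ b) ∧ q (a , b) ⟧) (allFin n))      ≡⟨ cong sum (map-tabulate id (λ b → ⟦ R (toℕ a) (toℕ b) ∧ q (a , b) ⟧)) ⟩
    sum (tabulate (λ b → ⟦ R (toℕ a) (toℕ b) ∧ q (a , b) ⟧))            ≡⟨ sum-tabulate n _ (λ _ → refl) ⟩
    ∑ n (λ b → ⟦ R (toℕ a) b ∧ Q (toℕ a) b ⟧)                          ∎

module Residues (n : ℕ) {{_ : NonZero n}} where

  infix 4 _≈_
  _≈_ : ℕ → ℕ → Set
  x ≈ y = x % n ≡ y % n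

  ≈-+ : ∀ {a a′ b b′} → a ≈ a′ → b ≈ b′ → a + b ≈ a′ + b′
  ≈-+ {a} {a′} {b} {b′} a≈a′ b≈b′ = begin
    (a + b) % n              ≡⟨ %-distribˡ-+ a b n ⟩
    (a % n + b % n) % n      ≡⟨ cong₂ (λ x y → (x + y) % n) a≈a′ b≈b′ ⟩
    (a′ % n + b′ % n) % n    ≡⟨ %-distribˡ-+ a′ b′ n ⟨
    (a′ + b′) % n            ∎

  infixl 6 _⊖_
  _⊖_ : ℕ → ℕ → ℕ
  y ⊖ x = (y + (n ∸ x)) % n

  ⊖<n : ∀ y x → y ⊖ x < n
  ⊖<n y x = m%n<n (y + (n ∸ x)) n

  ⊖-+ : ∀ y {x} → x ≤ n → y ⊖ x + x ≈ y
  ⊖-+ y {x} x≤n = begin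
    (y ⊖ x + x) % n          ≡⟨ [m%n+k]%n≡[m+k]%n (y + (n ∸ x)) x n ⟩
    (y + (n ∸ x) + x) % n    ≡⟨ cong (_% n) (+-assoc y (n ∸ x) x) ⟩
    (y + (n ∸ x + x)) % n    ≡⟨ cong (λ k → (y + k) % n) (m∸n+n≡m x≤n) ⟩
    (y + n) % n              ≡⟨ [m+n]%n≡m%n y n ⟩
    y % n                    ∎

  ⊖-unique : ∀ {x y z} → x ≤ n → z < n → z + x ≈ y → y ⊖ x ≡ z
  ⊖-unique {x} {y} {z} x≤n z<n z+x≈y = begin
    (y + (n ∸ x)) % n        ≡⟨ ≈-+ (sym z+x≈y) refl ⟩
    (z + x + (n ∸ x)) % n    ≡⟨ cong (_% n) (+-assoc z x (n ∸ x)) ⟩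
    (z + (x + (n ∸ x))) % n  ≡⟨ cong (λ k → (z + k) % n) (m+[n∸m]≡n x≤n) ⟩
    (z + n) % n              ≡⟨ [m+n]%n≡m%n z n ⟩
    z % n                    ≡⟨ m<n⇒m%n≡m z<n ⟩
    z                        ∎

  ⊖-identityʳ : ∀ {x} → x < n → x ⊖ 0 ≡ x
  ⊖-identityʳ {x} x<n = ⊖-unique z≤n x<n (cong (_% n) (+-identityʳ x))

  ⊖-self : ∀ {x} → x ≤ n → x ⊖ x ≡ 0
  ⊖-self x≤n = ⊖-unique x≤n (>-nonZero⁻¹ n) refl

  ⊖-translate : ∀ {x} y v → x ≤ n → (y + v) % n ⊖ (x + v) % n ≡ y ⊖ x
  ⊖-translate {x} y v x≤n = ⊖-unique (m%n≤n (x + v) n) (⊖<n y x) (begin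
    (y ⊖ x + (x + v) % n) % n  ≡⟨ ≈-+ {y ⊖ x} refl (m%n%n≡m%n (x + v) n) ⟩
    (y ⊖ x + (x + v)) % n      ≡⟨ cong (_% n) (+-assoc (y ⊖ x) x v) ⟨
    (y ⊖ x + x + v) % n        ≡⟨ ≈-+ (⊖-+ y x≤n) refl ⟩
    (y + v) % n                ≡⟨ m%n%n≡m%n (y + v) n ⟨
    (y + v) % n % n            ∎)

  ⊖-negate : ∀ {a b} → a ≤ n → b ≤ n → 0 ⊖ (b ⊖ a) ≡ a ⊖ b
  ⊖-negate {a} {b} a≤n b≤n = begin
    0 ⊖ (b ⊖ a)          ≡⟨ cong (_⊖ (b ⊖ a)) (⊖-self a≤n) ⟨
    (a ⊖ a) ⊖ (b ⊖ a)    ≡⟨ ⊖-translate a (n ∸ a) b≤n ⟩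
    a ⊖ b                ∎

  ≈-below-2n : ∀ {x y} → x < n + n → y < n → x ≈ y → x ≡ y ⊎ x ≡ y + n
  ≈-below-2n {x} {y} x<2n y<n x≈y with x <? n
  ... | yes x<n = inj₁ (begin
    x          ≡⟨ m<n⇒m%n≡m x<n ⟨
    x % n      ≡⟨ x≈y ⟩
    y % n      ≡⟨ m<n⇒m%n≡m y<n ⟩
    y          ∎)
  ... | no x≮n = inj₂ (begin
    x              ≡⟨ m∸n+n≡m n≤x ⟨
    x ∸ n + n      ≡⟨ cong (_+ n) (begin
      x ∸ n            ≡⟨ m<n⇒m%n≡m x∸n<n ⟨
      (x ∸ n) % n      ≡⟨ m≤n⇒[n∸m]%m≡n%m n≤x ⟩
      x % n            ≡⟨ x≈y ⟩
      y % n            ≡⟨ m<n⇒m%n≡m y<n ⟩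
      y                ∎) ⟩
    y + n          ∎)
    where
    n≤x : n ≤ x
    n≤x = ≮⇒≥ x≮n
    x∸n<n : x ∸ n < n
    x∸n<n = +-cancelʳ-< n (x ∸ n) n (subst (_< n + n) (sym (m∸n+n≡m n≤x)) x<2n)

  Square : ℕ × ℕ → Set
  Square (a , b) = a < n × b < n

  ∑² : (ℕ × ℕ → ℕ) → ℕ
  ∑² f = ∑ n (λ a → ∑ n (λ b → f (a , b)))

  ∑²-cong : ∀ {f g : ℕ × ℕ → ℕ} → (∀ x → Square x → f x ≡ g x) → ∑² f ≡ ∑² g
  ∑²-cong f≡g = ∑-cong n (λ a a<n → ∑-cong n (λ b b<n → f≡g (a , b) (a<n , b<n)))

  ∑²-zero : ∀ {f : ℕ × ℕ → ℕ} → (∀ x → Square x → f x ≡ 0) → ∑² f ≡ 0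
  ∑²-zero f≡0 = ∑-zero n (λ a a<n → ∑-zero n (λ b b<n → f≡0 (a , b) (a<n , b<n)))

  ∑²-distrib-+ : ∀ (f g : ℕ × ℕ → ℕ) → ∑² (λ x → f x + g x) ≡ ∑² f + ∑² g
  ∑²-distrib-+ f g = trans (∑-cong n (λ a _ → ∑-distrib-+ n (λ b → f (a , b)) (λ b → g (a , b)))) (∑-distrib-+ n _ _)

  ∑²-swapPair : ∀ {c c′} (f : ℕ × ℕ → ℕ) → c < c′ → c′ < n →
    (∀ x → Square x → x ≢ (c , c′) → x ≢ (c′ , c) → f x ≡ 0) → ∑² f ≡ f (c , c′) + f (c′ , c)
  ∑²-swapPair {c} {c′} f c<c′ c′<n f≡0 = begin
    ∑² f                                              ≡⟨ ∑-pair n _ c<c′ c′<n row≡0 ⟩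
    ∑ n (λ b → f (c , b)) + ∑ n (λ b → f (c′ , b))    ≡⟨ cong₂ _+_ (∑-single n _ c′<n row-c) (∑-single n _ c<n row-c′) ⟩
    f (c , c′) + f (c′ , c)                           ∎
    where
    c<n : c < n
    c<n = <-trans c<c′ c′<n
    row≡0 : ∀ a → a < n → a ≢ c → a ≢ c′ → ∑ n (λ b → f (a , b)) ≡ 0
    row≡0 a a<n a≢c a≢c′ = ∑-zero n (λ b b<n → f≡0 _ (a<n , b<n) (a≢c ∘ cong proj₁) (a≢c′ ∘ cong proj₁))
    row-c : ∀ b → b < n → b ≢ c′ → f (c , b) ≡ 0
    row-c b b<n b≢c′ = f≡0 _ (c<n , b<n) (b≢c′ ∘ cong proj₂) (<⇒≢ c<c′ ∘ cong proj₁)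
    row-c′ : ∀ b → b < n → b ≢ c → f (c′ , b) ≡ 0
    row-c′ b b<n b≢c = f≡0 _ (c′<n , b<n) (<⇒≢ c<c′ ∘ sym ∘ cong proj₁) (b≢c ∘ cong proj₂)

  ∑²-symmetric : ∀ (R : ℕ → ℕ → Bool) → (∀ a b → R a b ≡ R b a) → (∀ a → a < n → R a a ≡ false) →
    let X = ∑ n (λ a → ∑ n (λ b → ⟦ (a <ᵇ b) ∧ R a b ⟧)) in ∑² (λ (a , b) → ⟦ R a b ⟧) ≡ X + X
  ∑²-symmetric R R-sym R-irrefl = begin
    ∑² (λ (a , b) → ⟦ R a b ⟧)                                  ≡⟨ ∑²-cong (λ (a , b) (a<n , _) → split a b a<n) ⟩
    ∑² (λ (a , b) → ⟦ (a <ᵇ b) ∧ R a b ⟧ + ⟦ (b <ᵇ a) ∧ R b a ⟧) ≡⟨ ∑²-distrib-+ _ _ ⟩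
    X + ∑² (λ (a , b) → ⟦ (b <ᵇ a) ∧ R b a ⟧)                     ≡⟨ cong (X +_) (∑-comm n n (λ a b → ⟦ (b <ᵇ a) ∧ R b a ⟧)) ⟩
    X + X                                                       ∎
    where
    X : ℕ
    X = ∑ n (λ a → ∑ n (λ b → ⟦ (a <ᵇ b) ∧ R a b ⟧))
    split : ∀ a b → a < n → ⟦ R a b ⟧ ≡ ⟦ (a <ᵇ b) ∧ R a b ⟧ + ⟦ (b <ᵇ a) ∧ R b a ⟧
    split a b a<n with a <ᵇ b | <ᵇ-reflects-< a b | b <ᵇ a | <ᵇ-reflects-< b a
    ... | true  | ofʸ a<b | true  | ofʸ b<a = contradiction a<b (<-asym b<a)
    ... | true  | _       | false | _       = sym (+-identityʳ _)
    ... | false | _       | true  | _       = cong ⟦_⟧ (R-sym a b)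
    ... | false | ofⁿ a≮b | false | ofⁿ b≮a with ≤-antisym (≮⇒≥ b≮a) (≮⇒≥ a≮b)
    ...   | refl = cong ⟦_⟧ (R-irrefl a a<n)

  module OrderThree (g : ℕ × ℕ → ℕ × ℕ) (g-Square : ∀ x → Square (g x))
                    (g³ : ∀ x → Square x → g (g (g x)) ≡ x) (∑²-g : ∀ f → ∑² (f ∘ g) ≡ ∑² f) where

    _≟²_ : (x y : ℕ × ℕ) → Dec (x ≡ y)
    _≟²_ = ≡-dec _≟_ _≟_

    isFixed : ℕ × ℕ → Bool
    isFixed x = does (g x ≟² x)

    g²x≡gx⇒gx≡x : ∀ {x} → Square x → g (g x) ≡ g x → g x ≡ x
    g²x≡gx⇒gx≡x {x} x∈ g²x≡gx = sym (trans (sym (g³ x x∈)) (trans (cong g g²x≡gx) g²x≡gx))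

    isFixed-g : ∀ x → Square x → isFixed (g x) ≡ isFixed x
    isFixed-g x x∈ with g x ≟² x
    ... | yes gx≡x = dec-true (g (g x) ≟² g x) (cong g gx≡x)
    ... | no gx≢x  = dec-false (g (g x) ≟² g x) (gx≢x ∘ g²x≡gx⇒gx≡x x∈)

    key : ℕ × ℕ → ℕ
    key (a , b) = b + a * n

    key-injective : ∀ {x y} → Square x → Square y → key x ≡ key y → x ≡ y
    key-injective {a , b} {a′ , b′} (_ , b<n) (_ , b′<n) key≡ = cong₂ _,_ a≡a′ b≡b′
      where
      b≡b′ : b ≡ b′
      b≡b′ = begin
        b                  ≡⟨ m<n⇒m%n≡m b<n ⟨
        b % n              ≡⟨ [m+kn]%n≡m%n b a n ⟨
        (b + a * n) % n    ≡⟨ cong (_% n) key≡ ⟩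
        (b′ + a′ * n) % n  ≡⟨ [m+kn]%n≡m%n b′ a′ n ⟩
        b′ % n             ≡⟨ m<n⇒m%n≡m b′<n ⟩
        b′                 ∎
      a≡a′ : a ≡ a′
      a≡a′ = *-cancelʳ-≡ a a′ n (+-cancelˡ-≡ b _ _ (trans key≡ (cong (_+ a′ * n) (sym b≡b′))))

    isOrbitLeast : ℕ × ℕ → Bool
    isOrbitLeast x = isLeast (key x) (key (g x)) (key (g (g x)))

    orbit-has-one-least : ∀ x → Square x → g x ≢ x →
      ⟦ isOrbitLeast x ⟧ + ⟦ isOrbitLeast (g x) ⟧ + ⟦ isOrbitLeast (g (g x)) ⟧ ≡ 1
    orbit-has-one-least x x∈ gx≢x rewrite g³ x x∈ =
      leastCount-distinct (gx≢x ∘ sym ∘ key-injective x∈ gx∈) (g²x≢gx ∘ sym ∘ key-injective gx∈ g²x∈)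
                          (g²x≢x ∘ key-injective g²x∈ x∈)
      where
      gx∈ : Square (g x)
      gx∈ = g-Square x
      g²x∈ : Square (g (g x))
      g²x∈ = g-Square (g x)
      g²x≢gx : g (g x) ≢ g x
      g²x≢gx = gx≢x ∘ g²x≡gx⇒gx≡x x∈
      g²x≢x : g (g x) ≢ x
      g²x≢x g²x≡x = gx≢x (trans (cong g (sym g²x≡x)) (g³ x x∈))

    3∣∑²-invariant : ∀ (f : ℕ × ℕ → ℕ) → (∀ x → Square x → f (g x) ≡ f x) → (∀ x → g x ≡ x → f x ≡ 0) → 3 ∣ ∑² f
    3∣∑²-invariant f f∘g≡f f-fixed = divides K (begin
      ∑² f                                          ≡⟨ ∑²-cong weigh ⟩
      ∑² (λ x → fℓ x + fℓ (g x) + fℓ (g (g x)))      ≡⟨ ∑²-distrib-+ _ _ ⟩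
      ∑² (λ x → fℓ x + fℓ (g x)) + ∑² (fℓ ∘ g ∘ g)   ≡⟨ cong₂ _+_ (∑²-distrib-+ fℓ (fℓ ∘ g)) (trans (∑²-g (fℓ ∘ g)) (∑²-g fℓ)) ⟩
      K + ∑² (fℓ ∘ g) + K                           ≡⟨ cong (λ s → K + s + K) (∑²-g fℓ) ⟩
      K + K + K                                     ≡⟨ triple K ⟩
      3 * K                                         ≡⟨ *-comm 3 K ⟩
      K * 3                                         ∎)
      where
      ℓ : ℕ × ℕ → ℕ
      ℓ x = ⟦ isOrbitLeast x ⟧
      fℓ : ℕ × ℕ → ℕ
      fℓ x = f x * ℓ x
      K : ℕ
      K = ∑² fℓ
      weigh : ∀ x → Square x → f x ≡ fℓ x + fℓ (g x) + fℓ (g (g x))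
      weigh x x∈ = begin
        f x                                            ≡⟨ f≡f*count ⟩
        f x * (ℓ x + ℓ (g x) + ℓ (g (g x)))             ≡⟨ *-distribˡ-+ (f x) (ℓ x + ℓ (g x)) _ ⟩
        f x * (ℓ x + ℓ (g x)) + f x * ℓ (g (g x))       ≡⟨ cong (_+ f x * ℓ (g (g x))) (*-distribˡ-+ (f x) (ℓ x) _) ⟩
        f x * ℓ x + f x * ℓ (g x) + f x * ℓ (g (g x))   ≡⟨ cong₂ (λ u w → fℓ x + u * ℓ (g x) + w * ℓ (g (g x))) (sym f-gx) (sym f-g²x) ⟩
        fℓ x + fℓ (g x) + fℓ (g (g x))                  ∎
        where
        f-gx : f (g x) ≡ f x
        f-gx = f∘g≡f x x∈
        f-g²x : f (g (g x)) ≡ f x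
        f-g²x = trans (f∘g≡f (g x) (g-Square x)) f-gx
        f≡f*count : f x ≡ f x * (ℓ x + ℓ (g x) + ℓ (g (g x)))
        f≡f*count with g x ≟² x
        ... | yes gx≡x rewrite f-fixed x gx≡x = refl
        ... | no gx≢x  = sym (trans (cong (f x *_) (orbit-has-one-least x x∈ gx≢x)) (*-identityʳ (f x)))

  -- ρ translates the triangle {0, a, b} by −a and lists the images of b and 0.
  ρ : ℕ × ℕ → ℕ × ℕ
  ρ (a , b) = b ⊖ a , 0 ⊖ a

  ρ-Square : ∀ x → Square (ρ x)
  ρ-Square (a , b) = ⊖<n b a , ⊖<n 0 a

  ρ² : ∀ {a b} → a < n → b < n → ρ (ρ (a , b)) ≡ (0 ⊖ b , a ⊖ b)
  ρ² {a} {b} a<n b<n = cong₂ _,_ (⊖-translate 0 (n ∸ a) (<⇒≤ b<n)) (⊖-negate (<⇒≤ a<n) (<⇒≤ b<n))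

  ρ³ : ∀ x → Square x → ρ (ρ (ρ x)) ≡ x
  ρ³ (a , b) (a<n , b<n) = begin
    ρ (ρ (ρ (a , b)))                ≡⟨ cong ρ (ρ² a<n b<n) ⟩
    ((a ⊖ b) ⊖ (0 ⊖ b) , 0 ⊖ (0 ⊖ b)) ≡⟨ cong₂ _,_ (⊖-translate a (n ∸ b) z≤n) (⊖-negate (<⇒≤ b<n) z≤n) ⟩
    (a ⊖ 0 , b ⊖ 0)                  ≡⟨ cong₂ _,_ (⊖-identityʳ a<n) (⊖-identityʳ b<n) ⟩
    (a , b)                          ∎

  ∑²-ρ : ∀ f → ∑² (f ∘ ρ) ≡ ∑² f
  ∑²-ρ f = begin
    ∑ n (λ a → ∑ n (λ b → f (b ⊖ a , 0 ⊖ a)))  ≡⟨ ∑-cong n (λ a _ → ∑-translate n (n ∸ a) (λ b → f (b , 0 ⊖ a))) ⟩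
    ∑ n (λ a → ∑ n (λ b → f (b , 0 ⊖ a)))      ≡⟨ ∑-comm n n (λ a b → f (b , 0 ⊖ a)) ⟩
    ∑ n (λ b → ∑ n (λ a → f (b , 0 ⊖ a)))      ≡⟨ ∑-cong n (λ b _ → ∑-negate n (λ a → f (b , a))) ⟩
    ∑² f                                        ∎

  FixedShape : ℕ × ℕ → Set
  FixedShape x = x ≡ (0 , 0) ⊎ ∃[ m ] n ≡ 3 * m × (x ≡ (m , 2 * m) ⊎ x ≡ (2 * m , m))

  a+a≈b∧b+a≈0⇒FixedShape : ∀ {a b} → a < n → b < n → a + a ≈ b → b + a ≈ 0 → FixedShape (a , b)
  a+a≈b∧b+a≈0⇒FixedShape {a} {b} a<n b<n a+a≈b b+a≈0 with ≈-below-2n (+-mono-< b<n a<n) (>-nonZero⁻¹ n) b+a≈0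
  ... | inj₁ b+a≡0 = inj₁ (cong₂ _,_ (m+n≡0⇒n≡0 b b+a≡0) (m+n≡0⇒m≡0 b b+a≡0))
  ... | inj₂ b+a≡n with ≈-below-2n (+-mono-< a<n a<n) b<n a+a≈b
  ...   | inj₁ a+a≡b = inj₂ (a , n≡3a , inj₁ (cong (a ,_) (trans (sym a+a≡b) (double a))))
    where
    n≡3a : n ≡ 3 * a
    n≡3a = begin
      n          ≡⟨ b+a≡n ⟨
      b + a      ≡⟨ cong (_+ a) a+a≡b ⟨
      a + a + a  ≡⟨ triple a ⟩
      3 * a      ∎
  ...   | inj₂ a+a≡b+n = inj₂ (b , n≡3b , inj₂ (cong (_, b) (trans a≡b+b (double b))))
    where
    a≡b+b : a ≡ b + b
    a≡b+b = +-cancelʳ-≡ a a (b + b) (begin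
      a + a        ≡⟨ a+a≡b+n ⟩
      b + n        ≡⟨ cong (b +_) b+a≡n ⟨
      b + (b + a)  ≡⟨ +-assoc b b a ⟨
      b + b + a    ∎)
    n≡3b : n ≡ 3 * b
    n≡3b = begin
      n           ≡⟨ b+a≡n ⟨
      b + a       ≡⟨ cong (b +_) a≡b+b ⟩
      b + (b + b) ≡⟨ +-assoc b b b ⟨
      b + b + b   ≡⟨ triple b ⟩
      3 * b       ∎

  ρ-fixed : ∀ x → Square x → ρ x ≡ x → FixedShape x
  ρ-fixed (a , b) (a<n , b<n) ρx≡x = a+a≈b∧b+a≈0⇒FixedShape a<n b<n
    (subst (λ c → c + a ≈ b) (cong proj₁ ρx≡x) (⊖-+ b (<⇒≤ a<n)))
    (subst (λ c → c + a ≈ 0) (cong proj₂ ρx≡x) (⊖-+ 0 (<⇒≤ a<n)))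

  module Third {m : ℕ} (n≡3m : n ≡ 3 * m) where

    2m+m≡n : 2 * m + m ≡ n
    2m+m≡n = trans (solve 1 (λ m → con 2 :* m :+ m := con 3 :* m) refl m) (sym n≡3m)

    0<m : 0 < m
    0<m = n≢0⇒n>0 (λ m≡0 → ≢-nonZero⁻¹ n (trans n≡3m (cong (3 *_) m≡0)))

    m<2m : m < 2 * m
    m<2m = subst (m <_) (double m) (m<m+n m 0<m)

    2m<n : 2 * m < n
    2m<n = subst (2 * m <_) 2m+m≡n (m<m+n (2 * m) 0<m)

    m<n : m < n
    m<n = <-trans m<2m 2m<n

    n≈0 : n ≈ 0
    n≈0 = [m+n]%n≡m%n 0 n

    0⊖m : 0 ⊖ m ≡ 2 * m
    0⊖m = ⊖-unique (<⇒≤ m<n) 2m<n (trans (cong (_% n) 2m+m≡n) n≈0)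

    0⊖2m : 0 ⊖ 2 * m ≡ m
    0⊖2m = ⊖-unique (<⇒≤ 2m<n) m<n (trans (cong (_% n) (trans (+-comm m (2 * m)) 2m+m≡n)) n≈0)

    2m⊖m : 2 * m ⊖ m ≡ m
    2m⊖m = ⊖-unique (<⇒≤ m<n) m<n (cong (_% n) (double m))

    m⊖2m : m ⊖ 2 * m ≡ 2 * m
    m⊖2m = ⊖-unique (<⇒≤ 2m<n) 2m<n (begin
      (2 * m + 2 * m) % n  ≡⟨ cong (_% n) (solve 1 (λ m → con 2 :* m :+ con 2 :* m := m :+ (con 2 :* m :+ m)) refl m) ⟩
      (m + (2 * m + m)) % n ≡⟨ cong (λ k → (m + k) % n) 2m+m≡n ⟩
      (m + n) % n          ≡⟨ [m+n]%n≡m%n m n ⟩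
      m % n                ∎)

    ρ[m,2m] : ρ (m , 2 * m) ≡ (m , 2 * m)
    ρ[m,2m] = cong₂ _,_ 2m⊖m 0⊖m

    ρ[2m,m] : ρ (2 * m , m) ≡ (2 * m , m)
    ρ[2m,m] = cong₂ _,_ m⊖2m 0⊖2m

module Circulant (n : ℕ) {{_ : NonZero n}} (S : ℕ → Bool) where
  open Residues n

  -- On vertices, adjacent (toℕ u) (toℕ w) is definitionally adj n S u w.
  adjacent : ℕ → ℕ → Bool
  adjacent u w = S (w ⊖ u) ∨ S (u ⊖ w)

  triangle : ℕ → ℕ → ℕ → Bool
  triangle u v w = adjacent u v ∧ adjacent u w ∧ adjacent v w

  e≡∑ : ∀ v → e n S v ≡ ∑ n (λ a → ∑ n (λ b → ⟦ (a <ᵇ b) ∧ triangle (toℕ v) a b ⟧))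
  e≡∑ v = length-filter-pairs n _<ᵇ_ (triangle (toℕ v)) _ _

  adjacent-sym : ∀ u w → adjacent u w ≡ adjacent w u
  adjacent-sym u w = ∨-comm (S (w ⊖ u)) (S (u ⊖ w))

  adjacent-translate : ∀ {u w} t → u ≤ n → w ≤ n → adjacent ((u + t) % n) ((w + t) % n) ≡ adjacent u w
  adjacent-translate {u} {w} t u≤n w≤n = cong₂ _∨_ (cong S (⊖-translate w t u≤n)) (cong S (⊖-translate u t w≤n))

  triangle-swap : ∀ u v w → triangle u v w ≡ triangle u w v
  triangle-swap u v w = begin
    adjacent u v ∧ (adjacent u w ∧ adjacent v w)   ≡⟨ ∧-assoc (adjacent u v) _ _ ⟨
    (adjacent u v ∧ adjacent u w) ∧ adjacent v w   ≡⟨ cong₂ _∧_ (∧-comm (adjacent u v) _) (adjacent-sym v w) ⟩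
    (adjacent u w ∧ adjacent u v) ∧ adjacent w v   ≡⟨ ∧-assoc (adjacent u w) _ _ ⟩
    adjacent u w ∧ (adjacent u v ∧ adjacent w v)   ∎

  triangle-rotate : ∀ u v w → triangle u v w ≡ triangle v w u
  triangle-rotate u v w = begin
    adjacent u v ∧ (adjacent u w ∧ adjacent v w)   ≡⟨ ∧-assoc (adjacent u v) _ _ ⟨
    (adjacent u v ∧ adjacent u w) ∧ adjacent v w   ≡⟨ ∧-comm (adjacent u v ∧ adjacent u w) _ ⟩
    adjacent v w ∧ (adjacent u v ∧ adjacent u w)   ≡⟨ cong (adjacent v w ∧_) (cong₂ _∧_ (adjacent-sym u v) (adjacent-sym u w)) ⟩
    adjacent v w ∧ (adjacent v u ∧ adjacent w u)   ∎

  triangle-translate : ∀ {u v w} t → u ≤ n → v ≤ n → w ≤ n →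
    triangle ((u + t) % n) ((v + t) % n) ((w + t) % n) ≡ triangle u v w
  triangle-translate t u≤n v≤n w≤n =
    cong₂ _∧_ (adjacent-translate t u≤n v≤n) (cong₂ _∧_ (adjacent-translate t u≤n w≤n) (adjacent-translate t v≤n w≤n))

  triangle₀ : ℕ × ℕ → Bool
  triangle₀ (a , b) = triangle 0 a b

  ∑²-triangle-translate : ∀ {v} → v < n → ∑² (λ (a , b) → ⟦ triangle v a b ⟧) ≡ ∑² (⟦_⟧ ∘ triangle₀)
  ∑²-triangle-translate {v} v<n = begin
    ∑ n (λ a → ∑ n (λ b → ⟦ triangle v a b ⟧))                           ≡⟨ ∑-translate n v _ ⟨
    ∑ n (λ a → ∑ n (λ b → ⟦ triangle v ((a + v) % n) b ⟧))               ≡⟨ ∑-cong n (λ a _ → ∑-translate n v _) ⟨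
    ∑ n (λ a → ∑ n (λ b → ⟦ triangle v ((a + v) % n) ((b + v) % n) ⟧))   ≡⟨ ∑²-cong (λ x x∈ → cong ⟦_⟧ (translated x x∈)) ⟩
    ∑² (⟦_⟧ ∘ triangle₀)                                                 ∎
    where
    translated : ∀ x → Square x → triangle v ((proj₁ x + v) % n) ((proj₂ x + v) % n) ≡ triangle₀ x
    translated (a , b) (a<n , b<n) = begin
      triangle v ((a + v) % n) ((b + v) % n)        ≡⟨ cong (λ u → triangle u ((a + v) % n) ((b + v) % n)) (m<n⇒m%n≡m v<n) ⟨
      triangle (v % n) ((a + v) % n) ((b + v) % n)  ≡⟨ triangle-translate v z≤n (<⇒≤ a<n) (<⇒≤ b<n) ⟩
      triangle 0 a b                                ∎

  triangle₀-ρ : ∀ x → Square x → triangle₀ (ρ x) ≡ triangle₀ x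
  triangle₀-ρ (a , b) (a<n , b<n) = begin
    triangle 0 (b ⊖ a) (0 ⊖ a)         ≡⟨ cong (λ u → triangle u (b ⊖ a) (0 ⊖ a)) (⊖-self (<⇒≤ a<n)) ⟨
    triangle (a ⊖ a) (b ⊖ a) (0 ⊖ a)   ≡⟨ triangle-translate (n ∸ a) (<⇒≤ a<n) (<⇒≤ b<n) z≤n ⟩
    triangle a b 0                     ≡⟨ triangle-rotate a b 0 ⟩
    triangle b 0 a                     ≡⟨ triangle-rotate b 0 a ⟩
    triangle 0 a b                     ∎

  open OrderThree ρ ρ-Square ρ³ ∑²-ρ

  fixedTriangle movingTriangle : ℕ × ℕ → Bool
  fixedTriangle x = triangle₀ x ∧ isFixed x
  movingTriangle x = triangle₀ x ∧ not (isFixed x)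

  3∣∑²-movingTriangle : 3 ∣ ∑² (⟦_⟧ ∘ movingTriangle)
  3∣∑²-movingTriangle = 3∣∑²-invariant (⟦_⟧ ∘ movingTriangle)
    (λ x x∈ → cong₂ (λ t f → ⟦ t ∧ not f ⟧) (triangle₀-ρ x x∈) (isFixed-g x x∈))
    (λ x ρx≡x → trans (cong (λ f → ⟦ triangle₀ x ∧ not f ⟧) (dec-true (ρ x ≟² x) ρx≡x)) (cong ⟦_⟧ (∧-zeroʳ (triangle₀ x))))

  module _ (valid : ValidConn n S) where

    S0≡false : S 0 ≡ false
    S0≡false with S 0 in S0≡
    ... | true  = contradiction (proj₁ (valid 0 S0≡)) λ ()
    ... | false = refl

    S[2m]≡false : ∀ {m} → n ≡ 3 * m → S (2 * m) ≡ false
    S[2m]≡false {m} n≡3m with S (2 * m) in S2m≡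
    ... | false = refl
    ... | true  = contradiction (subst (λ k → 1 ≤ 2 * k) m≡0 1≤2m) λ ()
      where
      1≤2m : 1 ≤ 2 * m
      1≤2m = proj₁ (valid (2 * m) S2m≡)
      m+3m≤3m : m + 3 * m ≤ 0 + 3 * m
      m+3m≤3m = subst₂ _≤_ (solve 1 (λ m → con 2 :* m :* con 2 := m :+ con 3 :* m) refl m) n≡3m
        (≤-trans (*-monoˡ-≤ 2 (proj₂ (valid (2 * m) S2m≡))) (m/n*n≤m n 2))
      m≡0 : m ≡ 0
      m≡0 = n≤0⇒n≡0 (+-cancelʳ-≤ (3 * m) m 0 m+3m≤3m)

    adjacent-irrefl : ∀ {u} → u ≤ n → adjacent u u ≡ false
    adjacent-irrefl u≤n rewrite ⊖-self u≤n | S0≡false = refl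

    triangle-irrefl : ∀ v {a} → a ≤ n → triangle v a a ≡ false
    triangle-irrefl v {a} a≤n rewrite adjacent-irrefl a≤n | ∧-zeroʳ (adjacent v a) = ∧-zeroʳ (adjacent v a)

    e-double : ∀ v → e n S v + e n S v ≡ ∑² (⟦_⟧ ∘ fixedTriangle) + ∑² (⟦_⟧ ∘ movingTriangle)
    e-double v = begin
      e n S v + e n S v                                      ≡⟨ cong₂ _+_ (e≡∑ v) (e≡∑ v) ⟩
      X + X                                                  ≡⟨ ∑²-symmetric _ (triangle-swap u) (λ _ a<n → triangle-irrefl u (<⇒≤ a<n)) ⟨
      ∑² (λ (a , b) → ⟦ triangle u a b ⟧)                    ≡⟨ ∑²-triangle-translate (toℕ<n v) ⟩
      ∑² (⟦_⟧ ∘ triangle₀)                                   ≡⟨ ∑²-cong (λ x _ → ⟦⟧-split (triangle₀ x) (isFixed x)) ⟩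
      ∑² (λ x → ⟦ fixedTriangle x ⟧ + ⟦ movingTriangle x ⟧)  ≡⟨ ∑²-distrib-+ _ _ ⟩
      ∑² (⟦_⟧ ∘ fixedTriangle) + ∑² (⟦_⟧ ∘ movingTriangle)   ∎
      where
      u : ℕ
      u = toℕ v
      X : ℕ
      X = ∑ n (λ a → ∑ n (λ b → ⟦ (a <ᵇ b) ∧ triangle u a b ⟧))

    module _ {m} (n≡3m : n ≡ 3 * m) where
      open Third {m} n≡3m

      triangle₀[m,2m] : triangle₀ (m , 2 * m) ≡ S m
      triangle₀[m,2m] = begin
        adjacent 0 m ∧ adjacent 0 (2 * m) ∧ adjacent m (2 * m)
          ≡⟨ cong₂ _∧_ (cong₂ (λ i j → S i ∨ S j) (⊖-identityʳ m<n) 0⊖m)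
                       (cong₂ _∧_ (cong₂ (λ i j → S i ∨ S j) (⊖-identityʳ 2m<n) 0⊖2m) (cong₂ (λ i j → S i ∨ S j) 2m⊖m m⊖2m)) ⟩
        (S m ∨ S (2 * m)) ∧ (S (2 * m) ∨ S m) ∧ (S m ∨ S (2 * m))
          ≡⟨ cong (λ s → (S m ∨ s) ∧ (s ∨ S m) ∧ (S m ∨ s)) (S[2m]≡false {m} n≡3m) ⟩
        (S m ∨ false) ∧ S m ∧ (S m ∨ false)
          ≡⟨ cong (λ s → s ∧ S m ∧ s) (∨-identityʳ (S m)) ⟩
        S m ∧ S m ∧ S m
          ≡⟨ trans (cong (S m ∧_) (∧-idem (S m))) (∧-idem (S m)) ⟩
        S m ∎

      triangle₀[2m,m] : triangle₀ (2 * m , m) ≡ S m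
      triangle₀[2m,m] = trans (triangle-swap 0 (2 * m) m) triangle₀[m,2m]

    fixedTriangle-shape : ∀ x → Square x → fixedTriangle x ≡ true →
      ∃[ m ] n ≡ 3 * m × S m ≡ true × (x ≡ (m , 2 * m) ⊎ x ≡ (2 * m , m))
    fixedTriangle-shape x x∈ fixed with ρ x ≟² x
    ... | no _ = contradiction (trans (sym (∧-zeroʳ (triangle₀ x))) fixed) λ ()
    ... | yes ρx≡x with ρ-fixed x x∈ ρx≡x | trans (sym (∧-identityʳ (triangle₀ x))) fixed
    ...   | inj₁ refl                      | t≡true = contradiction (trans (sym (triangle-irrefl 0 z≤n)) t≡true) λ ()
    ...   | inj₂ (m , n≡3m , inj₁ refl)    | t≡true = m , n≡3m , trans (sym (triangle₀[m,2m] n≡3m)) t≡true , inj₁ refl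
    ...   | inj₂ (m , n≡3m , inj₂ refl)    | t≡true = m , n≡3m , trans (sym (triangle₀[2m,m] n≡3m)) t≡true , inj₂ refl

    ∑²-fixedTriangle-third : ∀ {m} → n ≡ 3 * m → ∑² (⟦_⟧ ∘ fixedTriangle) ≡ ⟦ S m ⟧ + ⟦ S m ⟧
    ∑²-fixedTriangle-third {m} n≡3m = begin
      ∑² (⟦_⟧ ∘ fixedTriangle)                                      ≡⟨ ∑²-swapPair _ m<2m 2m<n off-support ⟩
      ⟦ fixedTriangle (m , 2 * m) ⟧ + ⟦ fixedTriangle (2 * m , m) ⟧ ≡⟨ cong₂ _+_ (value (triangle₀[m,2m] n≡3m) ρ[m,2m])
                                                                                   (value (triangle₀[2m,m] n≡3m) ρ[2m,m]) ⟩
      ⟦ S m ⟧ + ⟦ S m ⟧                                             ∎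
      where
      open Third {m} n≡3m
      value : ∀ {x} → triangle₀ x ≡ S m → ρ x ≡ x → ⟦ fixedTriangle x ⟧ ≡ ⟦ S m ⟧
      value {x} t≡Sm ρx≡x = cong ⟦_⟧ (trans (cong₂ _∧_ t≡Sm (dec-true (ρ x ≟² x) ρx≡x)) (∧-identityʳ (S m)))
      m′≡m : ∀ {m′} → n ≡ 3 * m′ → m′ ≡ m
      m′≡m n≡3m′ = *-cancelˡ-≡ _ _ 3 (trans (sym n≡3m′) n≡3m)
      off-support : ∀ x → Square x → x ≢ (m , 2 * m) → x ≢ (2 * m , m) → ⟦ fixedTriangle x ⟧ ≡ 0
      off-support x x∈ x≢p x≢p′ with fixedTriangle x in fixed
      ... | false = refl
      ... | true with fixedTriangle-shape x x∈ fixed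
      ...   | m′ , n≡3m′ , _ , inj₁ x≡ = contradiction (trans x≡ (cong (λ k → k , 2 * k) (m′≡m n≡3m′))) x≢p
      ...   | m′ , n≡3m′ , _ , inj₂ x≡ = contradiction (trans x≡ (cong (λ k → 2 * k , k) (m′≡m n≡3m′))) x≢p′

    ∑²-fixedTriangle-none : (∀ m → n ≡ 3 * m → S m ≢ true) → ∑² (⟦_⟧ ∘ fixedTriangle) ≡ 0
    ∑²-fixedTriangle-none no-third = ∑²-zero vanish
      where
      vanish : ∀ x → Square x → ⟦ fixedTriangle x ⟧ ≡ 0
      vanish x x∈ with fixedTriangle x in fixed
      ... | false = refl
      ... | true with fixedTriangle-shape x x∈ fixed
      ...   | m , n≡3m , Sm , _ = contradiction Sm (no-third m n≡3m)

theorem3p2 : (n : ℕ) → {{_ : NonZero n}} → 2 ≤ n → (S : ℕ → Bool) → ValidConn n S → (v : Fin n) →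
    (((n % 3 ≡ 0) × (S (n / 3) ≡ true)) → e n S v % 3 ≡ 1) ×
    (¬ ((n % 3 ≡ 0) × (S (n / 3) ≡ true)) → e n S v % 3 ≡ 0)
theorem3p2 n _ S valid v = third , not-third
  where
  open Residues n
  open Circulant n S

  e%3≡ : ∀ c → ∑² (⟦_⟧ ∘ fixedTriangle) ≡ c + c → e n S v % 3 ≡ c % 3
  e%3≡ c fixed≡c+c = half-mod-3 (e n S v) c _ 3∣∑²-movingTriangle
    (trans (e-double valid v) (cong (_+ ∑² (⟦_⟧ ∘ movingTriangle)) fixed≡c+c))

  third : n % 3 ≡ 0 × S (n / 3) ≡ true → e n S v % 3 ≡ 1
  third (n%3≡0 , S[n/3]) = e%3≡ 1
    (trans (∑²-fixedTriangle-third valid (n%3≡0⇒n≡3[n/3] n%3≡0)) (cong (λ s → ⟦ s ⟧ + ⟦ s ⟧) S[n/3]))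

  not-third : ¬ (n % 3 ≡ 0 × S (n / 3) ≡ true) → e n S v % 3 ≡ 0
  not-third ¬third = e%3≡ 0 (∑²-fixedTriangle-none valid λ m n≡3m Sm →
    ¬third (n≡3m⇒n%3≡0 {m = m} n≡3m , subst (λ k → S k ≡ true) (sym (n≡3m⇒n/3≡m {m = m} n≡3m)) Sm))
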